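{- Let $\{a_n\}_{n\ge0}$ be a sequence in $\mathfrak{G}$ with $|a_n|>1$ for all $n\ge1$, satisfying Conditions (H) and (A), and let $\{p_n\},\{q_n\}$ be its $\mathcal{Q}$-pair. Then $|q_n|>\frac{\sqrt5+1}{2}|q_{n-2}|$ for all $n\ge2$.
   Context: $\mathfrak{G}$ is the ring of Gaussian integers. The $\mathcal{Q}$-pair: $p_{ -1}=1$, $p_0=a_0$, $p_{n+1}=a_{n+1}p_n+p_{n-1}$, $q_{ -1}=0$, $q_0=1$, $q_{n+1}=a_{n+1}q_n+q_{n-1}$. Let $\sigma_y(w)=-\bar w$ and $\sigma_y^k$ its $k$-fold iterate. Condition (H): for all $i,j$ with $1\le i<j$ such that $|a_j|=\sqrt2$ and $a_k=2\sigma_y^{j-k}(a_j)$ for all $k\in\{i+1,\dots,j-1\}$ (vacuous if $i=j-1$), either $a_i=2\sigma_y^{j-i}(a_j)$ or $|a_i-\sigma_y^{j-i}(a_j)|\ge2$. Condition (A): for all $n\ge1$ with $|a_n|\le2$, $\operatorname{Re}(a_na_{n+1})\ge\chi$, where $\chi=2$ if $|a_{n+1}|=\sqrt2$ and $\chi=0$ otherwise. -}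

module Defs where

open import Data.Nat as ℕ using (ℕ; zero; suc)
open import Data.Integer as ℤ using (ℤ; +_; -_; _+_; _*_; _-_; _≤_; _<_)
open import Data.Bool using (if_then_else_)
open import Relation.Nullary using (does)
open import Relation.Binary.PropositionalEquality using (_≡_)
open import Data.Product using (_×_)
open import Data.Sum using (_⊎_)

infix 4 _+i_
infixl 6 _+𝔊_ _-𝔊_
infixl 7 _*𝔊_
infix 4 _>φ·_

record 𝔊 : Set where
  constructor _+i_
  field
    re : ℤ
    im : ℤ
open 𝔊 public

0𝔊 1𝔊 : 𝔊
0𝔊 = + 0 +i + 0
1𝔊 = + 1 +i + 0

_+𝔊_ : 𝔊 → 𝔊 → 𝔊
(a +i b) +𝔊 (c +i d) = (a + c) +i (b + d)

_-𝔊_ : 𝔊 → 𝔊 → 𝔊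
(a +i b) -𝔊 (c +i d) = (a - c) +i (b - d)

_*𝔊_ : 𝔊 → 𝔊 → 𝔊
(a +i b) *𝔊 (c +i d) = (a * c - b * d) +i (a * d + b * c)

2· : 𝔊 → 𝔊
2· (a +i b) = (+ 2 * a) +i (+ 2 * b)

N : 𝔊 → ℤ
N (a +i b) = a * a + b * b

σy : 𝔊 → 𝔊
σy (a +i b) = (- a) +i b

σy^ : ℕ → 𝔊 → 𝔊
σy^ zero w = w
σy^ (suc k) w = σy (σy^ k w)

-- Q-pair. P a k = p_{k-1}, Q a k = q_{k-1}
P Q : (ℕ → 𝔊) → ℕ → 𝔊
P a zero = 1𝔊
P a (suc zero) = a 0
P a (suc (suc n)) = (a (suc n) *𝔊 P a (suc n)) +𝔊 P a n
Q a zero = 0𝔊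
Q a (suc zero) = 1𝔊
Q a (suc (suc n)) = (a (suc n) *𝔊 Q a (suc n)) +𝔊 Q a n

p q : (ℕ → 𝔊) → ℕ → 𝔊
p a n = P a (suc n)
q a n = Q a (suc n)

-- Condition (H);  |a_j| = √2  ⇔  N(a_j) = 2;  |w| ≥ 2  ⇔  N(w) ≥ 4
CondH : (ℕ → 𝔊) → Set
CondH a = ∀ i j → 1 ℕ.≤ i → i ℕ.< j → N (a j) ≡ + 2 →
  (∀ k → i ℕ.< k → k ℕ.< j → a k ≡ 2· (σy^ (j ℕ.∸ k) (a j))) →
  (a i ≡ 2· (σy^ (j ℕ.∸ i) (a j))) ⊎ (+ 4 ≤ N (a i -𝔊 σy^ (j ℕ.∸ i) (a j)))

χ : 𝔊 → ℤ
χ w = if does (N w ℤ.≟ + 2) then + 2 else + 0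

-- Condition (A);  |a_n| ≤ 2  ⇔  N(a_n) ≤ 4
CondA : (ℕ → 𝔊) → Set
CondA a = ∀ n → 1 ℕ.≤ n → N (a n) ≤ + 4 → χ (a (suc n)) ≤ re (a n *𝔊 a (suc n))

-- |z| > ((√5+1)/2)·|w|  for Gaussian integers z, w.
-- With x = N z, y = N w ≥ 0 and φ² = (3+√5)/2 this is  2x − 3y > √5·y,
-- i.e.  2x − 3y > 0  and  (2x − 3y)² > 5y².
_>φ·_ : 𝔊 → 𝔊 → Set
z >φ· w = (+ 0 < d) × (+ 5 * (N w * N w) < d * d)
  where d = + 2 * N z - + 3 * N w

module Submission where

-- We prove the stronger bound
-- |q_n|² > 3|q_{n-2}|², which gives |q_n| > φ|q_{n-2}| since φ² < 3 (>3·⇒>φ·).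
--
-- The module Growth then proves, for a sequence satisfying the hypotheses:
-- 1. |Q_k| is strictly increasing, by strong induction.  If |a_k|² ≥ 4 this
--    is the elementary bound |dX + Y| > |X| for |Y| < |X|.  Otherwise
--    |a_k|² = 2, and the cross-term identity moves the claim one index down,
--    replacing a_i by a_i − σ_y^{k-i}(a_k); Condition (H) says that this
--    coefficient has norm ≥ 4 or continues the chain, so the descent ends at
--    Q_1 = 1.
-- 2. |Q_{m+3}|² > 3|Q_{m+1}|².  Large partial quotients are handled by the
--    weighted norm identity; otherwise the quotients involved lie in the box,
--    and a tabulated certificate (valid for all tuples satisfying the local
--    forms of (A) and (H)) shows positivity of |Q_{m+3}|² − 3|Q_{m+1}|² as a
--    form in two earlier denominators, on the cone provided by step 1.

open import Defs
open import Data.Nat using (ℕ; _≤_; _∸_)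
open import Data.Integer using (+_)

open import Data.Nat as ℕ using (zero; suc; z≤n; s≤s)
import Data.Nat.Properties as ℕP
open import Data.Nat.Induction using (<-rec)
open import Data.Integer as ℤ using (ℤ; -[1+_]; 0ℤ; _+_; _*_; _-_; -_; +≤+; +<+)
import Data.Integer.Properties as ℤP
open import Data.Integer.Tactic.RingSolver using (solve-∀)
import Data.Sign as Sign
open import Data.Empty using (⊥-elim)
open import Data.Product using (_×_; _,_)
open import Data.Sum using (_⊎_; inj₁; inj₂)
open import Data.List using (List; []; _∷_; cartesianProductWith)
open import Data.List.Membership.Propositional using (_∈_)
open import Data.List.Membership.Propositional.Properties using (∈-cartesianProductWith⁺)
open import Data.List.Relation.Unary.Any using (here; there)
open import Data.List.Relation.Unary.All as All using (All; all?)
open import Relation.Nullary using (Dec; ¬_; ¬?; yes; no)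
open import Relation.Nullary.Decidable using (_×-dec_; _⊎-dec_; _→-dec_; map′; from-yes)
open import Relation.Binary.PropositionalEquality
  using (_≡_; refl; sym; trans; cong; cong₂; subst; subst₂; module ≡-Reasoning)

0≤+◃ : ∀ n → 0ℤ ℤ.≤ Sign.+ ℤ.◃ n
0≤+◃ n = subst (0ℤ ℤ.≤_) (sym (ℤP.+◃n≡+n n)) (+≤+ z≤n)

0≤sq : ∀ x → 0ℤ ℤ.≤ x * x
0≤sq (+ n)      = 0≤+◃ (n ℕ.* n)
0≤sq -[1+ n ]   = 0≤+◃ (suc n ℕ.* suc n)

0≤+ : ∀ {x y} → 0ℤ ℤ.≤ x → 0ℤ ℤ.≤ y → 0ℤ ℤ.≤ x + y
0≤+ = ℤP.+-mono-≤

0<+ : ∀ {x y} → 0ℤ ℤ.< x → 0ℤ ℤ.≤ y → 0ℤ ℤ.< x + y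
0<+ = ℤP.+-mono-<-≤

0≤* : ∀ {x y} → 0ℤ ℤ.≤ x → 0ℤ ℤ.≤ y → 0ℤ ℤ.≤ x * y
0≤* {+ m} {+ n} _ _ = 0≤+◃ (m ℕ.* n)

0<* : ∀ {x y} → 0ℤ ℤ.< x → 0ℤ ℤ.< y → 0ℤ ℤ.< x * y
0<* {+ suc m} {+ suc n} _         _         = +<+ (s≤s z≤n)
0<* {+ zero}  {_}       (+<+ ())  _
0<* {+ suc m} {+ zero}  _         (+<+ ())

0≤*-cancel : ∀ k {x} → 0ℤ ℤ.< k → 0ℤ ℤ.≤ k * x → 0ℤ ℤ.≤ x
0≤*-cancel k {x} 0<k 0≤kx =
  ℤP.*-cancelˡ-≤-pos 0ℤ x k {{ℤ.positive 0<k}} (subst (ℤ._≤ k * x) (sym (ℤP.*-zeroʳ k)) 0≤kx)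

0<*-cancel : ∀ k {x} → 0ℤ ℤ.< k → 0ℤ ℤ.< k * x → 0ℤ ℤ.< x
0<*-cancel k 0<k 0<kx =
  ℤP.*-cancelˡ-<-nonNeg k {{ℤ.nonNegative (ℤP.<⇒≤ 0<k)}}
    (subst (ℤ._< k * _) (sym (ℤP.*-zeroʳ k)) 0<kx)

<⇒diff-pos : ∀ {x y} → x ℤ.< y → 0ℤ ℤ.< y - x
<⇒diff-pos {x} {y} x<y = subst (ℤ._< y - x) (ℤP.+-inverseʳ x) (ℤP.+-monoˡ-< (- x) x<y)

diff-pos⇒< : ∀ {x y} → 0ℤ ℤ.< y - x → x ℤ.< y
diff-pos⇒< {x} {y} 0<y-x = subst₂ ℤ._<_ (ℤP.+-identityˡ x) (y-x+x≡y x y) (ℤP.+-monoˡ-< x 0<y-x)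
  where
  y-x+x≡y : ∀ x y → y - x + x ≡ y
  y-x+x≡y = solve-∀

conj : 𝔊 → 𝔊
conj (x +i y) = x +i (- y)

infixr 8 _·_
_·_ : ℤ → 𝔊 → 𝔊
k · (x +i y) = (k * x) +i (k * y)

0≤N : ∀ w → 0ℤ ℤ.≤ N w
0≤N (x +i y) = 0≤+ (0≤sq x) (0≤sq y)

-- The ring identities below are proved componentwise by the ring solver,
-- which needs the components of N, _*𝔊_, … spelled out as polynomials.

N-σy : ∀ w → N (σy w) ≡ N w
N-σy (x +i y) = identity x y
  where
  identity : ∀ (x y : ℤ) → - x * - x + y * y ≡ x * x + y * y
  identity = solve-∀

N-σy^ : ∀ k w → N (σy^ k w) ≡ N w
N-σy^ zero    w = refl
N-σy^ (suc k) w = trans (N-σy (σy^ k w)) (N-σy^ k w)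

N-* : ∀ u X → N (u *𝔊 X) ≡ N u * N X
N-* (ur +i ui) (xr +i xi) = identity ur ui xr xi
  where
  identity : ∀ (ur ui xr xi : ℤ) →
    (ur * xr - ui * xi) * (ur * xr - ui * xi) + (ur * xi + ui * xr) * (ur * xi + ui * xr)
    ≡ (ur * ur + ui * ui) * (xr * xr + xi * xi)
  identity = solve-∀

-- Weighted norm identity:  αβ|Z+Y|² = |αZ+βY|² + (β−α)(α|Z|² − β|Y|²).
-- For 0 ≤ α ≤ β it bounds |Z+Y| from below when |Z| dominates |Y|.
weighted-norm : ∀ α β Z Y →
  α * β * N (Z +𝔊 Y) ≡ N (α · Z +𝔊 β · Y) + (β - α) * (α * N Z - β * N Y)
weighted-norm α β (zr +i zi) (yr +i yi) = identity α β zr zi yr yi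
  where
  identity : ∀ (α β zr zi yr yi : ℤ) →
    α * β * ((zr + yr) * (zr + yr) + (zi + yi) * (zi + yi))
    ≡ (α * zr + β * yr) * (α * zr + β * yr) + (α * zi + β * yi) * (α * zi + β * yi)
      + (β - α) * (α * (zr * zr + zi * zi) - β * (yr * yr + yi * yi))
  identity = solve-∀

cross-term : ∀ c W X →
  N (c *𝔊 W +𝔊 X) - N c * N W - N X ≡ N (W -𝔊 σy c *𝔊 X) - N W - N c * N X
cross-term (cr +i ci) (wr +i wi) (xr +i xi) = identity cr ci wr wi xr xi
  where
  identity : ∀ (cr ci wr wi xr xi : ℤ) →
    let n : ℤ → ℤ → ℤ
        n a b = a * a + b * b
    in n (cr * wr - ci * wi + xr) (cr * wi + ci * wr + xi) - n cr ci * n wr wi - n xr xi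
       ≡ n (wr - (- cr * xr - ci * xi)) (wi - (- cr * xi + ci * xr)) - n wr wi - n cr ci * n xr xi
  identity = solve-∀

norm-2-transfer : ∀ c W X → N c ≡ + 2 →
  N (c *𝔊 W +𝔊 X) - N W ≡ N (W -𝔊 σy c *𝔊 X) - N X
norm-2-transfer c W X Nc≡2 = begin
  A - w                      ≡⟨ split-left A w x ⟩
  (A - + 2 * w - x) + (w + x) ≡⟨ cong (_+ (w + x)) cross ⟩
  (B - w - + 2 * x) + (w + x) ≡⟨ split-right B w x ⟩
  B - x                      ∎
  where
  open ≡-Reasoning
  A B w x : ℤ
  A = N (c *𝔊 W +𝔊 X)
  B = N (W -𝔊 σy c *𝔊 X)
  w = N W
  x = N X
  cross : A - + 2 * w - x ≡ B - w - + 2 * x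
  cross = subst (λ n → A - n * w - x ≡ B - w - n * x) Nc≡2 (cross-term c W X)
  split-left : ∀ A w x → A - w ≡ (A - + 2 * w - x) + (w + x)
  split-left = solve-∀
  split-right : ∀ B w x → (B - w - + 2 * x) + (w + x) ≡ B - x
  split-right = solve-∀

𝔊-ext : ∀ {z w} → re z ≡ re w → im z ≡ im w → z ≡ w
𝔊-ext = cong₂ _+i_

regroup : ∀ a c X Y → a *𝔊 X +𝔊 Y -𝔊 c *𝔊 X ≡ (a -𝔊 c) *𝔊 X +𝔊 Y
regroup (ar +i ai) (cr +i ci) (xr +i xi) (yr +i yi) =
  𝔊-ext (real ar ai cr ci xr xi yr) (imag ar ai cr ci xr xi yi)
  where
  real : ∀ (ar ai cr ci xr xi yr : ℤ) →
    ar * xr - ai * xi + yr - (cr * xr - ci * xi) ≡ (ar - cr) * xr - (ai - ci) * xi + yr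
  real = solve-∀
  imag : ∀ (ar ai cr ci xr xi yi : ℤ) →
    ar * xi + ai * xr + yi - (cr * xi + ci * xr) ≡ (ar - cr) * xi + (ai - ci) * xr + yi
  imag = solve-∀

2·w-w : ∀ w → 2· w -𝔊 w ≡ w
2·w-w (x +i y) = 𝔊-ext (identity x) (identity y)
  where
  identity : ∀ (x : ℤ) → + 2 * x - x ≡ x
  identity = solve-∀

c·1+0 : ∀ c → c *𝔊 1𝔊 +𝔊 0𝔊 ≡ c
c·1+0 (x +i y) = 𝔊-ext (real x y) (imag x y)
  where
  real : ∀ (x y : ℤ) → x * + 1 - y * + 0 + + 0 ≡ x
  real = solve-∀
  imag : ∀ (x y : ℤ) → x * + 0 + y * + 1 + + 0 ≡ y
  imag = solve-∀

Coeffs : Set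
Coeffs = 𝔊 × 𝔊

lin : Coeffs → 𝔊 → 𝔊 → 𝔊
lin (A , B) Y Y' = A *𝔊 Y +𝔊 B *𝔊 Y'

e₁ e₂ : Coeffs
e₁ = 1𝔊 , 0𝔊
e₂ = 0𝔊 , 1𝔊

step : 𝔊 → Coeffs → Coeffs → Coeffs
step c (A , B) (C , E) = c *𝔊 A +𝔊 C , c *𝔊 B +𝔊 E

lin-e₁ : ∀ Y Y' → lin e₁ Y Y' ≡ Y
lin-e₁ (yr +i yi) (zr +i zi) = 𝔊-ext (real yr yi zr zi) (imag yr yi zr zi)
  where
  real : ∀ (yr yi zr zi : ℤ) → + 1 * yr - + 0 * yi + (+ 0 * zr - + 0 * zi) ≡ yr
  real = solve-∀
  imag : ∀ (yr yi zr zi : ℤ) → + 1 * yi + + 0 * yr + (+ 0 * zi + + 0 * zr) ≡ yi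
  imag = solve-∀

lin-e₂ : ∀ Y Y' → lin e₂ Y Y' ≡ Y'
lin-e₂ (yr +i yi) (zr +i zi) = 𝔊-ext (real yr yi zr zi) (imag yr yi zr zi)
  where
  real : ∀ (yr yi zr zi : ℤ) → + 0 * yr - + 0 * yi + (+ 1 * zr - + 0 * zi) ≡ zr
  real = solve-∀
  imag : ∀ (yr yi zr zi : ℤ) → + 0 * yi + + 0 * yr + (+ 1 * zi + + 0 * zr) ≡ zi
  imag = solve-∀

lin-step : ∀ c u v Y Y' → c *𝔊 lin u Y Y' +𝔊 lin v Y Y' ≡ lin (step c u v) Y Y'
lin-step (cr +i ci) ((Ar +i Ai) , (Br +i Bi)) ((Cr +i Ci) , (Er +i Ei)) (yr +i yi) (zr +i zi) =
  𝔊-ext (real cr ci Ar Ai Br Bi Cr Ci Er Ei yr yi zr zi) (imag cr ci Ar Ai Br Bi Cr Ci Er Ei yr yi zr zi)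
  where
  real : ∀ (cr ci Ar Ai Br Bi Cr Ci Er Ei yr yi zr zi : ℤ) →
    let mr : ℤ → ℤ → ℤ → ℤ → ℤ
        mr a b c d = a * c - b * d
        mi : ℤ → ℤ → ℤ → ℤ → ℤ
        mi a b c d = a * d + b * c
    in mr cr ci (mr Ar Ai yr yi + mr Br Bi zr zi) (mi Ar Ai yr yi + mi Br Bi zr zi) + (mr Cr Ci yr yi + mr Er Ei zr zi)
       ≡ mr (mr cr ci Ar Ai + Cr) (mi cr ci Ar Ai + Ci) yr yi + mr (mr cr ci Br Bi + Er) (mi cr ci Br Bi + Ei) zr zi
  real = solve-∀
  imag : ∀ (cr ci Ar Ai Br Bi Cr Ci Er Ei yr yi zr zi : ℤ) →
    let mr : ℤ → ℤ → ℤ → ℤ → ℤ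
        mr a b c d = a * c - b * d
        mi : ℤ → ℤ → ℤ → ℤ → ℤ
        mi a b c d = a * d + b * c
    in mi cr ci (mr Ar Ai yr yi + mr Br Bi zr zi) (mi Ar Ai yr yi + mi Br Bi zr zi) + (mi Cr Ci yr yi + mi Er Ei zr zi)
       ≡ mi (mr cr ci Ar Ai + Cr) (mi cr ci Ar Ai + Ci) yr yi + mi (mr cr ci Br Bi + Er) (mi cr ci Br Bi + Ei) zr zi
  imag = solve-∀

-- coeffs a m k: the coefficients of Q a (k + m) with respect to
-- (Q a (m+1), Q a m); they depend only on a (m+1), …, a (m+k−1).
coeffs : (ℕ → 𝔊) → ℕ → ℕ → Coeffs
coeffs a m zero          = e₂
coeffs a m (suc zero)    = e₁
coeffs a m (suc (suc k)) = step (a (suc k ℕ.+ m)) (coeffs a m (suc k)) (coeffs a m k)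

Q-linear : ∀ a m k → Q a (k ℕ.+ m) ≡ lin (coeffs a m k) (Q a (suc m)) (Q a m)
Q-linear a m zero          = sym (lin-e₂ (Q a (suc m)) (Q a m))
Q-linear a m (suc zero)    = sym (lin-e₁ (Q a (suc m)) (Q a m))
Q-linear a m (suc (suc k)) =
  trans (cong₂ (λ U V → a (suc k ℕ.+ m) *𝔊 U +𝔊 V) (Q-linear a m (suc k)) (Q-linear a m k))
        (lin-step (a (suc k ℕ.+ m)) (coeffs a m (suc k)) (coeffs a m k) (Q a (suc m)) (Q a m))

data HForm : Set where
  hform : (p : ℤ) (t : 𝔊) (r : ℤ) → HForm

_⟦_,_⟧ : HForm → 𝔊 → 𝔊 → ℤ
hform p t r ⟦ X , Y ⟧ = p * N X + + 2 * re (t *𝔊 X *𝔊 conj Y) + r * N Y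

complete-square : ∀ p t r X Y →
  p * hform p t r ⟦ X , Y ⟧ ≡ N (p · X +𝔊 conj t *𝔊 Y) + (p * r - N t) * N Y
complete-square p (tr +i ti) r (xr +i xi) (yr +i yi) = identity p tr ti r xr xi yr yi
  where
  identity : ∀ (p tr ti r xr xi yr yi : ℤ) →
    let n : ℤ → ℤ → ℤ
        n a b = a * a + b * b
        mr : ℤ → ℤ → ℤ → ℤ → ℤ
        mr a b c d = a * c - b * d
        mi : ℤ → ℤ → ℤ → ℤ → ℤ
        mi a b c d = a * d + b * c
    in p * (p * n xr xi + + 2 * mr (mr tr ti xr xi) (mi tr ti xr xi) yr (- yi) + r * n yr yi)
       ≡ n (p * xr + mr tr (- ti) yr yi) (p * xi + mi tr (- ti) yr yi) + (p * r - n tr ti) * n yr yi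
  identity = solve-∀

PSD : HForm → Set
PSD (hform p t r) = 0ℤ ℤ.< p × N t ℤ.≤ p * r

psd? : ∀ F → Dec (PSD F)
psd? (hform p t r) = (0ℤ ℤ.<? p) ×-dec (N t ℤ.≤? p * r)

psd-nonneg : ∀ F X Y → PSD F → 0ℤ ℤ.≤ F ⟦ X , Y ⟧
psd-nonneg (hform p t r) X Y (0<p , t≤pr) = 0≤*-cancel p 0<p
  (subst (0ℤ ℤ.≤_) (sym (complete-square p t r X Y))
    (0≤+ (0≤N (p · X +𝔊 conj t *𝔊 Y)) (0≤* (ℤP.i≤j⇒0≤j-i t≤pr) (0≤N Y))))

-- S-lemma: F is positive on the cone k₁|X|² > k₂|Y|² as soon as, for some
-- μ > 0 and ν > 0, the form μF − ν(k₁|X|² − k₂|Y|²) is positive semidefinite.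
shifted : HForm → ℤ → ℤ → ℤ → ℤ → HForm
shifted (hform p t r) k₁ k₂ μ ν = hform (μ * p - ν * k₁) (μ · t) (μ * r + ν * k₂)

shifted-value : ∀ F k₁ k₂ μ ν X Y →
  shifted F k₁ k₂ μ ν ⟦ X , Y ⟧ ≡ μ * F ⟦ X , Y ⟧ - ν * (k₁ * N X - k₂ * N Y)
shifted-value (hform p (tr +i ti) r) k₁ k₂ μ ν (xr +i xi) (yr +i yi) =
  identity p tr ti r k₁ k₂ μ ν xr xi yr yi
  where
  identity : ∀ (p tr ti r k₁ k₂ μ ν xr xi yr yi : ℤ) →
    let n : ℤ → ℤ → ℤ
        n a b = a * a + b * b
        mr : ℤ → ℤ → ℤ → ℤ → ℤ
        mr a b c d = a * c - b * d
        mi : ℤ → ℤ → ℤ → ℤ → ℤ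
        mi a b c d = a * d + b * c
    in (μ * p - ν * k₁) * n xr xi
         + + 2 * mr (mr (μ * tr) (μ * ti) xr xi) (mi (μ * tr) (μ * ti) xr xi) yr (- yi)
         + (μ * r + ν * k₂) * n yr yi
       ≡ μ * (p * n xr xi + + 2 * mr (mr tr ti xr xi) (mi tr ti xr xi) yr (- yi) + r * n yr yi)
         - ν * (k₁ * n xr xi - k₂ * n yr yi)
  identity = solve-∀

Certificate : HForm → ℤ → ℤ → ℤ → ℤ → Set
Certificate F k₁ k₂ μ ν = 0ℤ ℤ.< ν × PSD (shifted F k₁ k₂ μ ν)

certificate? : ∀ F k₁ k₂ μ ν → Dec (Certificate F k₁ k₂ μ ν)
certificate? F k₁ k₂ μ ν = (0ℤ ℤ.<? ν) ×-dec psd? (shifted F k₁ k₂ μ ν)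

certificate-sound : ∀ F k₁ k₂ μ ν X Y → 0ℤ ℤ.< μ → Certificate F k₁ k₂ μ ν →
  0ℤ ℤ.< k₁ * N X - k₂ * N Y → 0ℤ ℤ.< F ⟦ X , Y ⟧
certificate-sound F k₁ k₂ μ ν X Y 0<μ (0<ν , psd-shifted) 0<cone = 0<*-cancel μ 0<μ
  (subst (0ℤ ℤ.<_) (sym (split (μ * F ⟦ X , Y ⟧) (ν * cone)))
    (ℤP.+-mono-≤-< 0≤shifted (0<* 0<ν 0<cone)))
  where
  cone : ℤ
  cone = k₁ * N X - k₂ * N Y
  0≤shifted : 0ℤ ℤ.≤ μ * F ⟦ X , Y ⟧ - ν * cone
  0≤shifted = subst (0ℤ ℤ.≤_) (shifted-value F k₁ k₂ μ ν X Y) (psd-nonneg (shifted F k₁ k₂ μ ν) X Y psd-shifted)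
  split : ∀ a b → a ≡ (a - b) + b
  split = solve-∀

excess : Coeffs → Coeffs → HForm
excess (A , B) (C , E) =
  hform (N A - + 3 * N C) (A *𝔊 conj B -𝔊 (+ 3) · (C *𝔊 conj E)) (N B - + 3 * N E)

excess-value : ∀ u v Y Y' → N (lin u Y Y') - + 3 * N (lin v Y Y') ≡ excess u v ⟦ Y , Y' ⟧
excess-value ((Ar +i Ai) , (Br +i Bi)) ((Cr +i Ci) , (Er +i Ei)) (yr +i yi) (zr +i zi) =
  identity Ar Ai Br Bi Cr Ci Er Ei yr yi zr zi
  where
  identity : ∀ (Ar Ai Br Bi Cr Ci Er Ei yr yi zr zi : ℤ) →
    let n : ℤ → ℤ → ℤ
        n a b = a * a + b * b
        mr : ℤ → ℤ → ℤ → ℤ → ℤ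
        mr a b c d = a * c - b * d
        mi : ℤ → ℤ → ℤ → ℤ → ℤ
        mi a b c d = a * d + b * c
        tr : ℤ
        tr = mr Ar Ai Br (- Bi) - (+ 3 * mr Cr Ci Er (- Ei))
        ti : ℤ
        ti = mi Ar Ai Br (- Bi) - (+ 3 * mi Cr Ci Er (- Ei))
    in n (mr Ar Ai yr yi + mr Br Bi zr zi) (mi Ar Ai yr yi + mi Br Bi zr zi)
         - + 3 * n (mr Cr Ci yr yi + mr Er Ei zr zi) (mi Cr Ci yr yi + mi Er Ei zr zi)
       ≡ (n Ar Ai - + 3 * n Cr Ci) * n yr yi
         + + 2 * mr (mr tr ti yr yi) (mi tr ti yr yi) zr (- zi)
         + (n Br Bi - + 3 * n Er Ei) * n zr zi
  identity = solve-∀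

Q-excess : ∀ a m k l →
  N (Q a (k ℕ.+ m)) - + 3 * N (Q a (l ℕ.+ m)) ≡ excess (coeffs a m k) (coeffs a m l) ⟦ Q a (suc m) , Q a m ⟧
Q-excess a m k l =
  trans (cong₂ (λ U V → N U - + 3 * N V) (Q-linear a m k) (Q-linear a m l))
        (excess-value (coeffs a m k) (coeffs a m l) (Q a (suc m)) (Q a m))

-- Lower bound from the weighted norm identity (dropping the square
-- |α(uX) + βY|²):  αβ|uX+Y|² ≥ (β−α)(α|u|²|X|² − β|Y|²).
weighted-bound : ∀ α β u X Y c →
  0ℤ ℤ.< (β - α) * (α * (N u * N X) - β * N Y) - c → c ℤ.< α * β * N (u *𝔊 X +𝔊 Y)
weighted-bound α β u X Y c 0<D-c = diff-pos⇒< (subst (0ℤ ℤ.<_) (sym expand) (ℤP.+-mono-≤-< (0≤N S) 0<D-c))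
  where
  open ≡-Reasoning
  S : 𝔊
  S = α · (u *𝔊 X) +𝔊 β · Y
  D : ℤ
  D = (β - α) * (α * (N u * N X) - β * N Y)
  expand : α * β * N (u *𝔊 X +𝔊 Y) - c ≡ N S + (D - c)
  expand = begin
    α * β * N (u *𝔊 X +𝔊 Y) - c
      ≡⟨ cong (_- c) (weighted-norm α β (u *𝔊 X) Y) ⟩
    N S + (β - α) * (α * N (u *𝔊 X) - β * N Y) - c
      ≡⟨ cong (λ z → N S + (β - α) * (α * z - β * N Y) - c) (N-* u X) ⟩
    N S + D - c
      ≡⟨ ℤP.+-assoc (N S) D (- c) ⟩
    N S + (D - c) ∎

escape-large : ∀ d X Y → + 4 ℤ.≤ N d → N Y ℤ.< N X → N X ℤ.< N (d *𝔊 X +𝔊 Y)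
escape-large d X Y 4≤d Y<X = ℤP.*-cancelˡ-<-nonNeg (+ 2)
  (weighted-bound (+ 1) (+ 2) d X Y (+ 2 * N X)
    (subst (0ℤ ℤ.<_) (sym (rearrange (N d) (N X) (N Y)))
      (ℤP.+-mono-≤-< (0≤* (ℤP.i≤j⇒0≤j-i 4≤d) (0≤N X)) (0<* {+ 2} (+<+ (s≤s z≤n)) (<⇒diff-pos Y<X)))))
  where
  rearrange : ∀ n x y → (+ 2 - + 1) * (+ 1 * (n * x) - + 2 * y) - + 2 * x ≡ (n - + 4) * x + + 2 * (x - y)
  rearrange = solve-∀

triple-large-u : ∀ u X Y → + 8 ℤ.≤ N u → N Y ℤ.< N X → + 3 * N Y ℤ.< N (u *𝔊 X +𝔊 Y)
triple-large-u u X Y 8≤u Y<X = ℤP.*-cancelˡ-<-nonNeg (+ 2)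
  (weighted-bound (+ 1) (+ 2) u X Y (+ 2 * (+ 3 * N Y))
    (subst (0ℤ ℤ.<_) (sym (rearrange (N u) (N X) (N Y)))
      (ℤP.+-mono-≤-< (0≤* (ℤP.i≤j⇒0≤j-i 8≤u) (0≤N X)) (0<* {+ 8} (+<+ (s≤s z≤n)) (<⇒diff-pos Y<X)))))
  where
  rearrange : ∀ n x y → (+ 2 - + 1) * (+ 1 * (n * x) - + 2 * y) - + 2 * (+ 3 * y) ≡ (n - + 8) * x + + 8 * (x - y)
  rearrange = solve-∀

triple-large-ratio : ∀ u X Y → + 2 ℤ.≤ N u → + 4 * N Y ℤ.< N X → + 3 * N Y ℤ.< N (u *𝔊 X +𝔊 Y)
triple-large-ratio u X Y 2≤u 4Y<X = ℤP.*-cancelˡ-<-nonNeg (+ 2)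
  (weighted-bound (+ 1) (+ 2) u X Y (+ 2 * (+ 3 * N Y))
    (subst (0ℤ ℤ.<_) (sym (rearrange (N u) (N X) (N Y)))
      (ℤP.+-mono-≤-< (0≤* (ℤP.i≤j⇒0≤j-i 2≤u) (0≤N X)) (0<* {+ 2} (+<+ (s≤s z≤n)) (<⇒diff-pos 4Y<X)))))
  where
  rearrange : ∀ n x y → (+ 2 - + 1) * (+ 1 * (n * x) - + 2 * y) - + 2 * (+ 3 * y) ≡ (n - + 2) * x + + 2 * (x - + 4 * y)
  rearrange = solve-∀

quadruple-large-b : ∀ b Y Y' → + 9 ℤ.≤ N b → N Y' ℤ.< N Y → + 4 * N Y ℤ.< N (b *𝔊 Y +𝔊 Y')
quadruple-large-b b Y Y' 9≤b Y'<Y = ℤP.*-cancelˡ-<-nonNeg (+ 3)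
  (weighted-bound (+ 1) (+ 3) b Y Y' (+ 3 * (+ 4 * N Y))
    (subst (0ℤ ℤ.<_) (sym (rearrange (N b) (N Y) (N Y')))
      (ℤP.+-mono-≤-< (0≤* {+ 2} (+≤+ z≤n) (0≤* (ℤP.i≤j⇒0≤j-i 9≤b) (0≤N Y))) (0<* {+ 6} (+<+ (s≤s z≤n)) (<⇒diff-pos Y'<Y)))))
  where
  rearrange : ∀ n y y' → (+ 3 - + 1) * (+ 1 * (n * y) - + 3 * y') - + 3 * (+ 4 * y) ≡ + 2 * ((n - + 9) * y) + + 6 * (y - y')
  rearrange = solve-∀

ratio-large-e : ∀ e Y Y' → + 5 ℤ.≤ N e → N Y' ℤ.< N Y → 0ℤ ℤ.< + 36 * N (e *𝔊 Y +𝔊 Y') - + 55 * N Y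
ratio-large-e e Y Y' 5≤e Y'<Y = <⇒diff-pos
  (weighted-bound (+ 4) (+ 9) e Y Y' (+ 55 * N Y)
    (subst (0ℤ ℤ.<_) (sym (rearrange (N e) (N Y) (N Y')))
      (ℤP.+-mono-≤-< (0≤* {+ 20} (+≤+ z≤n) (0≤* (ℤP.i≤j⇒0≤j-i 5≤e) (0≤N Y))) (0<* {+ 45} (+<+ (s≤s z≤n)) (<⇒diff-pos Y'<Y)))))
  where
  rearrange : ∀ n y y' → (+ 9 - + 4) * (+ 4 * (n * y) - + 9 * y') - + 55 * y ≡ + 20 * ((n - + 5) * y) + + 45 * (y - y')
  rearrange = solve-∀

range : List ℤ
range = -[1+ 1 ] ∷ -[1+ 0 ] ∷ + 0 ∷ + 1 ∷ + 2 ∷ []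

box : List 𝔊
box = cartesianProductWith _+i_ range range

9≤sq : ∀ k → 9 ℕ.≤ (3 ℕ.+ k) ℕ.* (3 ℕ.+ k)
9≤sq k = ℕP.*-mono-≤ {3} {3 ℕ.+ k} {3} {3 ℕ.+ k} (ℕP.m≤m+n 3 k) (ℕP.m≤m+n 3 k)

sq≤8⇒∈range : ∀ x → x * x ℤ.≤ + 8 → x ∈ range
sq≤8⇒∈range (+ 0)                 _          = there (there (here refl))
sq≤8⇒∈range (+ 1)                 _          = there (there (there (here refl)))
sq≤8⇒∈range (+ 2)                 _          = there (there (there (there (here refl))))
sq≤8⇒∈range (+ suc (suc (suc k))) (+≤+ sq≤8) = ⊥-elim (ℕP.≤⇒≯ sq≤8 (9≤sq k))
sq≤8⇒∈range -[1+ 0 ]              _          = there (here refl)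
sq≤8⇒∈range -[1+ 1 ]              _          = here refl
sq≤8⇒∈range -[1+ suc (suc k) ]    (+≤+ sq≤8) = ⊥-elim (ℕP.≤⇒≯ sq≤8 (9≤sq k))

box-complete : ∀ w → N w ℤ.≤ + 8 → w ∈ box
box-complete (x +i y) w≤8 = ∈-cartesianProductWith⁺ _+i_
  (sq≤8⇒∈range x (ℤP.≤-trans (ℤP.i≤i+j (x * x) (y * y) {{ℤ.nonNegative (0≤sq y)}}) w≤8))
  (sq≤8⇒∈range y (ℤP.≤-trans (ℤP.i≤j+i (y * y) (x * x) {{ℤ.nonNegative (0≤sq x)}}) w≤8))

in-box : ∀ w k → N w ℤ.< + k → k ℕ.≤ 9 → w ∈ box
in-box w k w<k k≤9 = box-complete w (ℤP.≤-trans (ℤP.i<j⇒i≤pred[j] w<k) (pred≤8 k k≤9))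
  where
  pred≤8 : ∀ k → k ℕ.≤ 9 → ℤ.pred (+ k) ℤ.≤ + 8
  pred≤8 zero    _         = ℤ.-≤+
  pred≤8 (suc k) (s≤s k≤8) = +≤+ k≤8

_≟𝔊_ : (z w : 𝔊) → Dec (z ≡ w)
(a +i b) ≟𝔊 (c +i d) =
  map′ (λ (a≡c , b≡d) → cong₂ _+i_ a≡c b≡d) (λ e → cong re e , cong im e) ((a ℤ.≟ c) ×-dec (b ℤ.≟ d))

-- Condition (A) for consecutive partial quotients b = a_n, c = a_{n+1}.
LocalA : 𝔊 → 𝔊 → Set
LocalA b c = N b ℤ.≤ + 4 → χ c ℤ.≤ re (b *𝔊 c)

-- Condition (H) for (i, j) = (n, n+1), with b = a_n, c = a_{n+1}.
LocalH₁ : 𝔊 → 𝔊 → Set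
LocalH₁ b c = N c ≡ + 2 → b ≡ 2· (σy c) ⊎ + 4 ℤ.≤ N (b -𝔊 σy c)

-- Condition (H) for (i, j) = (n, n+2), with e = a_n, b = a_{n+1}, c = a_{n+2}.
LocalH₂ : 𝔊 → 𝔊 → 𝔊 → Set
LocalH₂ e b c = N c ≡ + 2 → b ≡ 2· (σy c) → e ≡ 2· (σy (σy c)) ⊎ + 4 ℤ.≤ N (e -𝔊 σy (σy c))

-- Local conditions on consecutive partial quotients x = a_{n+1}, y = a_n
-- (and z = a_{n-1}).
Admissible₂ : 𝔊 → 𝔊 → Set
Admissible₂ x y = + 2 ℤ.≤ N x × + 2 ℤ.≤ N y × LocalA y x × LocalH₁ y x

Admissible₃ : 𝔊 → 𝔊 → 𝔊 → Set
Admissible₃ x y z = Admissible₂ x y × + 2 ℤ.≤ N z × LocalA z y × LocalH₁ z y × LocalH₂ z y x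

admissible₂? : ∀ x y → Dec (Admissible₂ x y)
admissible₂? x y =
  (+ 2 ℤ.≤? N x) ×-dec (+ 2 ℤ.≤? N y)
  ×-dec (N y ℤ.≤? + 4 →-dec χ x ℤ.≤? re (y *𝔊 x))
  ×-dec (N x ℤ.≟ + 2 →-dec (y ≟𝔊 2· (σy x) ⊎-dec + 4 ℤ.≤? N (y -𝔊 σy x)))

admissible₃? : ∀ x y z → Dec (Admissible₃ x y z)
admissible₃? x y z =
  admissible₂? x y ×-dec (+ 2 ℤ.≤? N z)
  ×-dec (N z ℤ.≤? + 4 →-dec χ y ℤ.≤? re (z *𝔊 y))
  ×-dec (N y ℤ.≟ + 2 →-dec (z ≟𝔊 2· (σy y) ⊎-dec + 4 ℤ.≤? N (z -𝔊 σy y)))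
  ×-dec (N x ℤ.≟ + 2 →-dec y ≟𝔊 2· (σy x) →-dec (z ≟𝔊 2· (σy (σy x)) ⊎-dec + 4 ℤ.≤? N (z -𝔊 σy (σy x))))

two-step : 𝔊 → 𝔊 → Coeffs
two-step x y = step x (step y e₁ e₂) e₁

three-step : 𝔊 → 𝔊 → 𝔊 → Coeffs
three-step x y z = step x (step y (step z e₁ e₂) e₁) (step z e₁ e₂)

coeffs-3 : ∀ a m → coeffs a m 3 ≡ two-step (a (2 ℕ.+ m)) (a (suc m))
coeffs-3 a m = refl

coeffs-4 : ∀ a m → coeffs a m 4 ≡ three-step (a (3 ℕ.+ m)) (a (2 ℕ.+ m)) (a (suc m))
coeffs-4 a m = refl

excess₂ : 𝔊 → 𝔊 → HForm
excess₂ x y = excess (two-step x y) e₁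

excess₃ : 𝔊 → 𝔊 → 𝔊 → HForm
excess₃ x y z = excess (three-step x y z) (step z e₁ e₂)

-- The multiplier ν = k₂p − k₁r balances the two diagonal entries.
balanced : ℤ → ℤ → HForm → ℤ
balanced k₁ k₂ (hform p t r) = k₂ * p - k₁ * r

Certified₂ : 𝔊 → 𝔊 → Set
Certified₂ x y = Certificate (excess₂ x y) (+ 36) (+ 55) (+ 3960) (balanced (+ 36) (+ 55) (excess₂ x y))

Certified₃ : 𝔊 → 𝔊 → 𝔊 → Set
Certified₃ x y z = Certificate (excess₃ x y z) (+ 1) (+ 1) (+ 2) (balanced (+ 1) (+ 1) (excess₃ x y z))

certified₂? : ∀ x y → Dec (Certified₂ x y)
certified₂? x y = certificate? (excess₂ x y) (+ 36) (+ 55) (+ 3960) (balanced (+ 36) (+ 55) (excess₂ x y))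

certified₃? : ∀ x y z → Dec (Certified₃ x y z)
certified₃? x y z = certificate? (excess₃ x y z) (+ 1) (+ 1) (+ 2) (balanced (+ 1) (+ 1) (excess₃ x y z))

table₂ : All (λ x → All (λ y → Admissible₂ x y → Certified₂ x y) box) box
table₂ = from-yes (all? (λ x → all? (λ y → admissible₂? x y →-dec certified₂? x y) box) box)

table₃ : All (λ x → All (λ y → All (λ z → Admissible₃ x y z → Certified₃ x y z) box) box) box
table₃ = from-yes (all? (λ x → all? (λ y → all? (λ z → admissible₃? x y z →-dec certified₃? x y z) box) box) box)

norm≢3 : All (λ w → ¬ N w ≡ + 3) box
norm≢3 = from-yes (all? (λ w → ¬? (N w ℤ.≟ + 3)) box)

norm-2-or-≥4 : ∀ w → + 2 ℤ.≤ N w → N w ≡ + 2 ⊎ + 4 ℤ.≤ N w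
norm-2-or-≥4 w 2≤w with + 4 ℤ.≤? N w
... | yes 4≤w = inj₂ 4≤w
... | no  4≰w = inj₁ (ℤP.≤-antisym (ℤP.i<j⇒i≤pred[j] (ℤP.≤∧≢⇒< w≤3 w≢3)) 2≤w)
  where
  w≤3 : N w ℤ.≤ + 3
  w≤3 = ℤP.i<j⇒i≤pred[j] (ℤP.≰⇒> 4≰w)
  w≢3 : ¬ N w ≡ + 3
  w≢3 = All.lookup norm≢3 (box-complete w (ℤP.≤-trans w≤3 (+≤+ (s≤s (s≤s (s≤s z≤n))))))

-- |z|² > 3|w|² implies |z| > φ|w|:  with u = |z|² − 3|w|² > 0, both
-- 2|z|² − 3|w|² = 2u + 3|w|²  and  (2|z|² − 3|w|²)² − 5|w|⁴ = 4u² + 12u|w|² + 4|w|⁴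
-- are positive.
>3·⇒>φ· : ∀ z w → + 3 * N w ℤ.< N z → z >φ· w
>3·⇒>φ· z w 3w<z =
  subst (0ℤ ℤ.<_) (sym (linear (N z) (N w))) (0<+ (0<* {+ 2} (+<+ (s≤s z≤n)) 0<u) (0≤* {+ 3} (+≤+ z≤n) (0≤N w))) ,
  diff-pos⇒< (subst (0ℤ ℤ.<_) (sym (quadratic (N z) (N w)))
    (0<+ (0<+ (0<* {+ 4} (+<+ (s≤s z≤n)) (0<* 0<u 0<u)) (0≤* {+ 12} (+≤+ z≤n) (0≤* (ℤP.<⇒≤ 0<u) (0≤N w))))
         (0≤* {+ 4} (+≤+ z≤n) (0≤sq (N w)))))
  where
  0<u : 0ℤ ℤ.< N z - + 3 * N w
  0<u = <⇒diff-pos 3w<z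
  linear : ∀ x y → + 2 * x - + 3 * y ≡ + 2 * (x - + 3 * y) + + 3 * y
  linear = solve-∀
  quadratic : ∀ x y → (+ 2 * x - + 3 * y) * (+ 2 * x - + 3 * y) - + 5 * (y * y)
                      ≡ + 4 * ((x - + 3 * y) * (x - + 3 * y)) + + 12 * ((x - + 3 * y) * y) + + 4 * (y * y)
  quadratic = solve-∀

∸-peel : ∀ j i → i ℕ.< j → j ∸ i ≡ suc (j ∸ suc i)
∸-peel (suc j) i (s≤s i≤j) = ℕP.+-∸-assoc 1 i≤j

σy^-shift : ∀ d n w → σy^ ((d ℕ.+ n) ∸ n) w ≡ σy^ d w
σy^-shift d n w = cong (λ e → σy^ e w) (ℕP.m+n∸n≡m d n)

module Growth (a : ℕ → 𝔊) (large : ∀ n → 1 ≤ n → + 2 ℤ.≤ N (a n))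
              (condH : CondH a) (condA : CondA a) where

  Increasing : ℕ → Set
  Increasing k = N (Q a k) ℤ.< N (Q a (suc k))

  Escapes : 𝔊 → ℕ → Set
  Escapes c i = N (Q a (suc i)) ℤ.< N (c *𝔊 Q a (suc i) +𝔊 Q a i)

  Chain : ℕ → ℕ → Set
  Chain i j = ∀ k → i ℕ.< k → k ℕ.< j → a k ≡ 2· (σy^ (j ∸ k) (a j))

  -- The step i+1 → i uses norm-2-transfer and Condition (H) for (i+1, j).
  descent : ∀ {j} → N (a j) ≡ + 2 → (∀ {k} → k ℕ.< j → Increasing k) →
            ∀ i → i ℕ.< j → Chain i j → Escapes (σy^ (j ∸ suc i) (a j)) i
  descent {j} aj≡2 below zero 0<j _ =
    subst (+ 1 ℤ.<_) (sym (trans (cong N (c·1+0 c)) (trans (N-σy^ (j ∸ 1) (a j)) aj≡2))) (+<+ (s≤s (s≤s z≤n)))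
    where
    c : 𝔊
    c = σy^ (j ∸ 1) (a j)
  descent {j} aj≡2 below (suc i) i<j chain = diff-pos⇒< (subst (0ℤ ℤ.<_) (sym transfer) (<⇒diff-pos escape))
    where
    c cᵢ X Y : 𝔊
    c  = σy^ (j ∸ suc (suc i)) (a j)
    cᵢ = σy^ (j ∸ suc i) (a j)
    X  = Q a (suc i)
    Y  = Q a i
    σc≡cᵢ : σy c ≡ cᵢ
    σc≡cᵢ = cong (λ e → σy^ e (a j)) (sym (∸-peel j (suc i) i<j))
    transfer : N (c *𝔊 Q a (suc (suc i)) +𝔊 X) - N (Q a (suc (suc i))) ≡ N ((a (suc i) -𝔊 cᵢ) *𝔊 X +𝔊 Y) - N X
    transfer = trans (norm-2-transfer c (Q a (suc (suc i))) X (trans (N-σy^ (j ∸ suc (suc i)) (a j)) aj≡2))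
                     (cong (λ w → N w - N X) (trans (regroup (a (suc i)) (σy c) X Y)
                                                     (cong (λ w → (a (suc i) -𝔊 w) *𝔊 X +𝔊 Y) σc≡cᵢ)))
    escape : N X ℤ.< N ((a (suc i) -𝔊 cᵢ) *𝔊 X +𝔊 Y)
    escape with condH (suc i) j (s≤s z≤n) i<j aj≡2 chain
    ... | inj₂ 4≤ = escape-large (a (suc i) -𝔊 cᵢ) X Y 4≤ (below (ℕP.<-trans (ℕP.n<1+n i) i<j))
    ... | inj₁ ai≡2cᵢ =
      subst (λ w → N X ℤ.< N (w *𝔊 X +𝔊 Y)) (sym (trans (cong (_-𝔊 cᵢ) ai≡2cᵢ) (2·w-w cᵢ)))
        (descent aj≡2 below i (ℕP.<-trans (ℕP.n<1+n i) i<j) longer-chain)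
      where
      longer-chain : Chain i j
      longer-chain k i<k k<j with ℕP.m≤n⇒m<n∨m≡n i<k
      ... | inj₁ i+1<k = chain k i+1<k k<j
      ... | inj₂ refl  = ai≡2cᵢ

  increasing : ∀ k → Increasing k
  increasing = <-rec Increasing from-below
    where
    from-below : ∀ k → (∀ {i} → i ℕ.< k → Increasing i) → Increasing k
    from-below zero    _  = +<+ (s≤s z≤n)
    from-below (suc k) IH with norm-2-or-≥4 (a (suc k)) (large (suc k) (s≤s z≤n))
    ... | inj₂ 4≤ = escape-large (a (suc k)) (Q a (suc k)) (Q a k) 4≤ (IH (ℕP.n<1+n k))
    ... | inj₁ ≡2 = subst (λ e → Escapes (σy^ e (a (suc k))) k) (ℕP.n∸n≡0 k)
                      (descent ≡2 IH k (ℕP.n<1+n k) (λ _ k<i i<k+1 → ⊥-elim (ℕP.<⇒≱ i<k+1 k<i)))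

  localH₁ : ∀ m → LocalH₁ (a (suc m)) (a (2 ℕ.+ m))
  localH₁ m c≡2 = subst (λ w → a (suc m) ≡ 2· w ⊎ + 4 ℤ.≤ N (a (suc m) -𝔊 w)) (σy^-shift 1 (suc m) (a (2 ℕ.+ m)))
    (condH (suc m) (2 ℕ.+ m) (s≤s z≤n) (ℕP.n<1+n (suc m)) c≡2 (λ _ m+1<k k<m+2 → ⊥-elim (ℕP.<⇒≱ k<m+2 m+1<k)))

  localH₂ : ∀ m → LocalH₂ (a (suc m)) (a (2 ℕ.+ m)) (a (3 ℕ.+ m))
  localH₂ m c≡2 b≡2σc = subst (λ w → a (suc m) ≡ 2· w ⊎ + 4 ℤ.≤ N (a (suc m) -𝔊 w)) (σy^-shift 2 (suc m) (a (3 ℕ.+ m)))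
    (condH (suc m) (3 ℕ.+ m) (s≤s z≤n) (ℕP.m<n+m (suc m) {2} (s≤s z≤n)) c≡2 chain)
    where
    chain : Chain (suc m) (3 ℕ.+ m)
    chain k m+1<k k<m+3 with ℕP.≤-antisym (ℕP.≤-pred k<m+3) m+1<k
    ... | refl = trans b≡2σc (cong 2· (sym (σy^-shift 1 (2 ℕ.+ m) (a (3 ℕ.+ m)))))

  admissible₂ : ∀ m → Admissible₂ (a (2 ℕ.+ m)) (a (suc m))
  admissible₂ m = large (2 ℕ.+ m) (s≤s z≤n) , large (suc m) (s≤s z≤n) , condA (suc m) (s≤s z≤n) , localH₁ m

  admissible₃ : ∀ m → Admissible₃ (a (3 ℕ.+ m)) (a (2 ℕ.+ m)) (a (suc m))
  admissible₃ m = admissible₂ (suc m) , large (suc m) (s≤s z≤n) , condA (suc m) (s≤s z≤n) , localH₁ m , localH₂ m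

  triple-two-step : ∀ m → N (a (2 ℕ.+ m)) ℤ.< + 8 → N (a (suc m)) ℤ.< + 9 →
    0ℤ ℤ.< + 36 * N (Q a (suc m)) - + 55 * N (Q a m) → + 3 * N (Q a (suc m)) ℤ.< N (Q a (3 ℕ.+ m))
  triple-two-step m x<8 y<9 cone = diff-pos⇒< (subst (0ℤ ℤ.<_) (sym as-form)
    (certificate-sound (excess₂ x y) (+ 36) (+ 55) (+ 3960) (balanced (+ 36) (+ 55) (excess₂ x y))
       (Q a (suc m)) (Q a m) (+<+ (s≤s z≤n)) certified cone))
    where
    x y : 𝔊
    x = a (2 ℕ.+ m)
    y = a (suc m)
    as-form : N (Q a (3 ℕ.+ m)) - + 3 * N (Q a (suc m)) ≡ excess₂ x y ⟦ Q a (suc m) , Q a m ⟧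
    as-form = trans (Q-excess a m 3 1) (cong (λ u → excess u e₁ ⟦ Q a (suc m) , Q a m ⟧) (coeffs-3 a m))
    certified : Certified₂ x y
    certified = All.lookup (All.lookup table₂ (in-box x 8 x<8 (ℕP.n≤1+n 8))) (in-box y 9 y<9 ℕP.≤-refl) (admissible₂ m)

  triple-three-step : ∀ m → N (a (3 ℕ.+ m)) ℤ.< + 8 → N (a (2 ℕ.+ m)) ℤ.< + 9 → N (a (suc m)) ℤ.< + 5 →
    + 3 * N (Q a (2 ℕ.+ m)) ℤ.< N (Q a (4 ℕ.+ m))
  triple-three-step m x<8 y<9 z<5 = diff-pos⇒< (subst (0ℤ ℤ.<_) (sym as-form)
    (certificate-sound (excess₃ x y z) (+ 1) (+ 1) (+ 2) (balanced (+ 1) (+ 1) (excess₃ x y z))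
       (Q a (suc m)) (Q a m) (+<+ (s≤s z≤n)) certified cone))
    where
    x y z : 𝔊
    x = a (3 ℕ.+ m)
    y = a (2 ℕ.+ m)
    z = a (suc m)
    as-form : N (Q a (4 ℕ.+ m)) - + 3 * N (Q a (2 ℕ.+ m)) ≡ excess₃ x y z ⟦ Q a (suc m) , Q a m ⟧
    as-form = trans (Q-excess a m 4 2) (cong (λ u → excess u (coeffs a m 2) ⟦ Q a (suc m) , Q a m ⟧) (coeffs-4 a m))
    certified : Certified₃ x y z
    certified = All.lookup (All.lookup (All.lookup table₃ (in-box x 8 x<8 (ℕP.n≤1+n 8)))
                  (in-box y 9 y<9 ℕP.≤-refl)) (in-box z 5 z<5 (ℕP.m≤m+n 5 4)) (admissible₃ m)
    cone : 0ℤ ℤ.< + 1 * N (Q a (suc m)) - + 1 * N (Q a m)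
    cone = subst (0ℤ ℤ.<_) (unit-weights (N (Q a (suc m))) (N (Q a m))) (<⇒diff-pos (increasing m))
      where
      unit-weights : ∀ s t → s - t ≡ + 1 * s - + 1 * t
      unit-weights = solve-∀

  -- |Q_{m+3}|² > 3|Q_{m+1}|² when a_{m+2} and a_{m+1} are small: the two-step
  -- certificate applies on the cone supplied by m = 0 (Q_0 = 0) or by a large
  -- a_m; otherwise a_m is small too and the three-step certificate applies.
  triple-small : ∀ m → N (a (2 ℕ.+ m)) ℤ.< + 8 → N (a (suc m)) ℤ.< + 9 →
    + 3 * N (Q a (suc m)) ℤ.< N (Q a (3 ℕ.+ m))
  triple-small zero    x<8 y<9 = triple-two-step zero x<8 y<9 (+<+ (s≤s z≤n))
  triple-small (suc m) x<8 y<9 with + 5 ℤ.≤? N (a (suc m))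
  ... | yes 5≤z = triple-two-step (suc m) x<8 y<9 (ratio-large-e (a (suc m)) (Q a (suc m)) (Q a m) 5≤z (increasing m))
  ... | no  5≰z = triple-three-step m x<8 y<9 (ℤP.≰⇒> 5≰z)

  triple : ∀ m → + 3 * N (Q a (suc m)) ℤ.< N (Q a (3 ℕ.+ m))
  triple m with + 8 ℤ.≤? N (a (2 ℕ.+ m)) | + 9 ℤ.≤? N (a (suc m))
  ... | yes 8≤x | _ = triple-large-u (a (2 ℕ.+ m)) (Q a (2 ℕ.+ m)) (Q a (suc m)) 8≤x (increasing (suc m))
  ... | no _    | yes 9≤y = triple-large-ratio (a (2 ℕ.+ m)) (Q a (2 ℕ.+ m)) (Q a (suc m)) (large (2 ℕ.+ m) (s≤s z≤n))
                              (quadruple-large-b (a (suc m)) (Q a (suc m)) (Q a m) 9≤y (increasing m))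
  ... | no 8≰x  | no 9≰y  = triple-small m (ℤP.≰⇒> 8≰x) (ℤP.≰⇒> 9≰y)

proposition5p11 : (a : ℕ → 𝔊) → (∀ n → 1 ≤ n → + 2 Data.Integer.≤ N (a n)) →
    CondH a → CondA a →
    ∀ n → 2 ≤ n → q a n >φ· q a (n ∸ 2)
proposition5p11 a large condH condA (suc (suc m)) (s≤s (s≤s z≤n)) =
  >3·⇒>φ· (q a (2 ℕ.+ m)) (q a m) (Growth.triple a large condH condA m)
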